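{- Let $v\ge1$, $n=2^v$, and let $\omega$ be a prime orbit of $\mathbf{K}[v,1]$ containing the minterm $\mu=m_s\wedge\bigwedge_{i=0}^{n-1}\Diamond^{\varepsilon_i}m_i$. Then $\omega$ consists exactly of all minterms $\mu'=m_{s'}\wedge\bigwedge_{i=0}^{n-1}\Diamond^{\varepsilon'_i}m_i$ such that $\varepsilon'_{s'}=\varepsilon_s$ and $\chi(\varepsilon')=\chi(\varepsilon)$.
   Context: $m_0,\dots,m_{n-1}$ enumerate the $n=2^v$ Boolean minterms $\bigwedge_{k=0}^{v-1}\pm p_k$ in the variables $p_0,\dots,p_{v-1}$. For $\varepsilon_i\in\{0,1\}$ write $\Diamond^{1}m_i=\Diamond m_i$ and $\Diamond^{0}m_i=\neg\Diamond m_i$. $\mathbf{K}[v,1]$ is the Lindenbaum–Tarski algebra (modulo provable equivalence in the least normal modal logic $\mathbf{K}$) of formulas in $p_0,\dots,p_{v-1}$ of modal degree $\le1$; its atoms (minterms) are exactly the $n\cdot2^n$ formulas $m_s\wedge\bigwedge_{i=0}^{n-1}\Diamond^{\varepsilon_i}m_i$, $0\le s<n$, $\varepsilon\in\{0,1\}^n$. For $\varepsilon\in\{0,1\}^n$, $\chi(\varepsilon)$ is the number of $i$ with $\varepsilon_i=1$. A level-0 substitution is a tuple $(\sigma_0,\dots,\sigma_{v-1})$ of classical propositional formulas in $p_0,\dots,p_{v-1}$ acting by $\varphi\circ\sigma=\varphi(\sigma_0,\dots,\sigma_{v-1})$; under composition $(\sigma\sigma')_i=\sigma_i(\sigma'_0,\dots,\sigma'_{v-1})$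 they form a monoid whose invertible elements (prime substitutions) form a group $\mathcal{S}_p(v,0)$; it acts on the minterms of $\mathbf{K}[v,1]$ by $\mu\mapsto\mu\circ\varsigma$ (which is again a minterm up to $\mathbf{K}$-equivalence). The orbits of this action are the prime orbits of $\mathbf{K}[v,1]$. -}

module Defs where

open import Data.Nat using (ℕ; zero; suc; _+_)
open import Data.Bool using (Bool; true; false; _∧_; _∨_; not; if_then_else_)
open import Data.Fin using (Fin)
open import Data.Vec using (Vec; []; _∷_; lookup)
open import Data.List using (List; []; _∷_; map; _++_; foldr)
open import Data.Nat.ListAction using (sum)
open import Data.List.Base using (allFin)
open import Data.Product using (Σ; _×_)
open import Relation.Binary.PropositionalEquality using (_≡_)

-- Valuations of p₀ … p_{v-1}; they index the n = 2^v Boolean minterms.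
Val : ℕ → Set
Val v = Vec Bool v

allVals : (v : ℕ) → List (Val v)
allVals zero    = [] ∷ []
allVals (suc v) = map (true ∷_) (allVals v) ++ map (false ∷_) (allVals v)

data Fm (v : ℕ) : Set where
  var  : Fin v → Fm v
  ⊥ᶠ   : Fm v
  ¬ᶠ_  : Fm v → Fm v
  _∧ᶠ_ : Fm v → Fm v → Fm v

evalF : ∀ {v} → Fm v → Val v → Bool
evalF (var k)  x = lookup x k
evalF ⊥ᶠ       x = false
evalF (¬ᶠ φ)   x = not (evalF φ x)
evalF (φ ∧ᶠ ψ) x = evalF φ x ∧ evalF ψ x

-- classical (provable = semantic) equivalence
_≈ᶜ_ : ∀ {v} → Fm v → Fm v → Set
φ ≈ᶜ ψ = ∀ x → evalF φ x ≡ evalF ψ x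

-- Modal formulas of modal degree ≤ 1 (◇ applied to classical formulas)

data MFm (v : ℕ) : Set where
  var  : Fin v → MFm v
  ⊥ᵐ   : MFm v
  ¬ᵐ_  : MFm v → MFm v
  _∧ᵐ_ : MFm v → MFm v → MFm v
  ◇_   : Fm v → MFm v

embed : ∀ {v} → Fm v → MFm v
embed (var k)  = var k
embed ⊥ᶠ       = ⊥ᵐ
embed (¬ᶠ φ)   = ¬ᵐ embed φ
embed (φ ∧ᶠ ψ) = embed φ ∧ᵐ embed ψ

-- Truth of a degree-≤1 formula at the root of a Kripke model depends only on
-- the root valuation x and the set R of valuations realised at successors.
anyV : ∀ {v} → (Val v → Bool) → Bool
anyV {v} f = foldr (λ y b → f y ∨ b) false (allVals v)

evalM : ∀ {v} → MFm v → Val v → (Val v → Bool) → Bool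
evalM (var k)  x R = lookup x k
evalM ⊥ᵐ       x R = false
evalM (¬ᵐ φ)   x R = not (evalM φ x R)
evalM (φ ∧ᵐ ψ) x R = evalM φ x R ∧ evalM ψ x R
evalM (◇ φ)    x R = anyV (λ y → R y ∧ evalF φ y)

-- equivalence in K (for degree ≤ 1 formulas, via completeness of K)
_≈ᴷ_ : ∀ {v} → MFm v → MFm v → Set
φ ≈ᴷ ψ = ∀ x R → evalM φ x R ≡ evalM ψ x R

Subst : ℕ → Set
Subst v = Fin v → Fm v

_[_]ᶠ : ∀ {v} → Fm v → Subst v → Fm v
var k    [ σ ]ᶠ = σ k
⊥ᶠ       [ σ ]ᶠ = ⊥ᶠ
(¬ᶠ φ)   [ σ ]ᶠ = ¬ᶠ (φ [ σ ]ᶠ)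
(φ ∧ᶠ ψ) [ σ ]ᶠ = (φ [ σ ]ᶠ) ∧ᶠ (ψ [ σ ]ᶠ)

_[_]ᵐ : ∀ {v} → MFm v → Subst v → MFm v
var k    [ σ ]ᵐ = embed (σ k)
⊥ᵐ       [ σ ]ᵐ = ⊥ᵐ
(¬ᵐ φ)   [ σ ]ᵐ = ¬ᵐ (φ [ σ ]ᵐ)
(φ ∧ᵐ ψ) [ σ ]ᵐ = (φ [ σ ]ᵐ) ∧ᵐ (ψ [ σ ]ᵐ)
(◇ φ)    [ σ ]ᵐ = ◇ (φ [ σ ]ᶠ)

_⊙_ : ∀ {v} → Subst v → Subst v → Subst v
(σ ⊙ τ) i = σ i [ τ ]ᶠ

idS : ∀ {v} → Subst v
idS = var

Prime : ∀ {v} → Subst v → Set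
Prime {v} σ = Σ (Subst v) λ τ →
  (∀ i → (σ ⊙ τ) i ≈ᶜ idS i) × (∀ i → (τ ⊙ σ) i ≈ᶜ idS i)

conjF : ∀ {v} → List (Fm v) → Fm v
conjF []       = ¬ᶠ ⊥ᶠ
conjF (φ ∷ φs) = φ ∧ᶠ conjF φs

conjM : ∀ {v} → List (MFm v) → MFm v
conjM []       = ¬ᵐ ⊥ᵐ
conjM (φ ∷ φs) = φ ∧ᵐ conjM φs

lit : ∀ {v} → Fin v → Bool → Fm v
lit k true  = var k
lit k false = ¬ᶠ var k

mt : ∀ {v} → Val v → Fm v
mt {v} x = conjF (map (λ k → lit k (lookup x k)) (allFin v))

dia^ : ∀ {v} → Bool → Fm v → MFm v
dia^ true  m = ◇ m
dia^ false m = ¬ᵐ (◇ m)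

μ : ∀ {v} → Val v → (Val v → Bool) → MFm v
μ {v} s ε = embed (mt s) ∧ᵐ conjM (map (λ i → dia^ (ε i) (mt i)) (allVals v))

χ : ∀ {v} → (Val v → Bool) → ℕ
χ {v} ε = sum (map (λ i → if ε i then 1 else 0) (allVals v))

InPrimeOrbit : ∀ {v} → MFm v → MFm v → Set
InPrimeOrbit {v} μ₀ μ' = Σ (Subst v) λ σ → Prime σ × ((μ₀ [ σ ]ᵐ) ≈ᴷ μ')

{-# OPTIONS --safe #-}
module Submission where

-- A formula of modal degree ≤ 1 is evaluated at a pair (x, R) of a root valuation and a set of
-- successor valuations, and the minterm μ s ε holds at exactly one such pair, namely (s, ε).
-- A prime substitution σ acts on valuations by a permutation f, and μ s ε ∘ σ holds exactly at
-- (f⁻¹ s, ε ∘ f); conversely, via disjunctive normal forms, every permutation of the valuations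
-- comes from a prime substitution. So μ s′ ε′ lies in the orbit of μ s ε iff some permutation f
-- satisfies f s′ = s and ε ∘ f = ε′. Such an f gives ε′ s′ = ε (f s′) = ε s, and χ ε′ = χ ε since
-- f is a bijection. Conversely, if ε′ s′ = ε s and χ ε′ = χ ε, transpositions repairing one
-- disagreement of ε and ε′ at a time give f with ε ∘ f = ε′, and a last transposition moves f s′ to s.

open import Defs
open import Data.Nat using (ℕ; zero; suc; _+_; _≤_; _<_; s<s⁻¹)
open import Data.Nat.Properties using (+-cancelˡ-≡; <-trans; n<1+n; ≤-reflexive)
open import Data.Nat.ListAction using (sum)
open import Data.Nat.ListAction.Properties using (sum-↭)
open import Data.Bool using (Bool; true; false; T; _∧_; _∨_; not; if_then_else_)
open import Data.Bool.Properties using (T-≡; T-not-≡; T-∧; T-∨; not-involutive) renaming (_≟_ to _≟ᴮ_)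
open import Data.Empty using (⊥-elim)
open import Data.Fin using (Fin)
open import Data.Product using (_×_; _,_; proj₁; proj₂; ∃-syntax; Σ-syntax)
import Data.Sum as Sum
open import Data.Unit using (tt)
open import Data.Vec using ([]; _∷_; lookup; tabulate)
open import Data.Vec.Properties using (∷-injectiveʳ; lookup∘tabulate; tabulate∘lookup; tabulate-cong; ≡-dec)
open import Data.List using (List; []; _∷_; map; foldr; allFin)
open import Data.List.Properties using (map-∘; map-cong)
open import Data.List.Membership.Propositional using (_∈_; _∉_; find; lose)
open import Data.List.Membership.Propositional.Properties using (∈-map⁺; ∈-map⁻; ∈-++⁺ˡ; ∈-++⁺ʳ)
open import Data.List.Membership.Propositional.Properties.WithK using (unique∧set⇒bag)
open import Data.List.Relation.Unary.Any as Any using (Any; here; there)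
open import Data.List.Relation.Unary.All as All using (All)
import Data.List.Relation.Unary.All.Properties as All
open import Data.List.Relation.Unary.AllPairs using ([]; _∷_)
open import Data.List.Relation.Unary.Unique.Propositional using (Unique)
import Data.List.Relation.Unary.Unique.Propositional.Properties as Unique
open import Data.List.Relation.Binary.Permutation.Propositional using (_↭_)
import Data.List.Relation.Binary.Permutation.Propositional.Properties as ↭
open import Data.List.Relation.Binary.BagAndSetEquality using (∼bag⇒↭)
open import Function using (_∘_; _$_)
open import Function.Bundles using (_⇔_; _↔_; mk⇔; mk↔ₛ′; Inverse; Equivalence; Injection)
open import Function.Construct.Composition using (_↔-∘_; _⇔-∘_)
open import Function.Construct.Identity using (↔-id)
open import Function.Properties.Inverse using (↔⇒↣)
open import Relation.Binary.Definitions using (DecidableEquality)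
open import Relation.Binary.PropositionalEquality
  using (_≡_; _≢_; refl; sym; trans; cong; cong₂; subst; module ≡-Reasoning)
open import Relation.Nullary using (¬_; yes; no; contradiction)

open Inverse using (to; from; strictlyInverseˡ; strictlyInverseʳ; inverseˡ; inverseʳ)
module ⇔ = Equivalence

count : {X : Set} → (X → Bool) → List X → ℕ
count P xs = sum (map (λ x → if P x then 1 else 0) xs)

module _ {X : Set} where

  count-cong : {P Q : X → Bool} (xs : List X) → (∀ x → P x ≡ Q x) → count P xs ≡ count Q xs
  count-cong xs P≗Q = cong sum (map-cong (λ x → cong (λ b → if b then 1 else 0) (P≗Q x)) xs)

  count-∘-↔ : (P : X → Bool) (f : X ↔ X) {xs : List X} → Unique xs →
              (∀ {x} → x ∈ xs → to f x ∈ xs) → (∀ {x} → x ∈ xs → from f x ∈ xs) →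
              count (P ∘ to f) xs ≡ count P xs
  count-∘-↔ P f {xs} xs! to∈ from∈ = begin
    count (P ∘ to f) xs      ≡⟨ cong sum (map-∘ xs) ⟩
    count P (map (to f) xs)  ≡⟨ sum-↭ (↭.map⁺ _ map-to-↭) ⟩
    count P xs               ∎
    where
    open ≡-Reasoning
    same-elements : ∀ {x} → x ∈ map (to f) xs ⇔ x ∈ xs
    same-elements {x} = mk⇔
      (λ x∈ → let (y , y∈ , x≡fy) = ∈-map⁻ (to f) x∈ in subst (_∈ xs) (sym x≡fy) (to∈ y∈))
      (λ x∈ → subst (_∈ map (to f) xs) (strictlyInverseˡ f x) (∈-map⁺ (to f) (from∈ x∈)))
    map-to-↭ : map (to f) xs ↭ xs
    map-to-↭ = ∼bag⇒↭ $
      unique∧set⇒bag (Unique.map⁺ (Injection.injective (↔⇒↣ f)) xs!) xs! same-elements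

  count-<⇒disagreement : (P Q : X → Bool) (xs : List X) → count P xs < count Q xs →
                         Any (λ x → P x ≡ false × Q x ≡ true) xs
  count-<⇒disagreement P Q (x ∷ xs) lt with P x in Px | Q x in Qx
  ... | false | true  = here (Px , Qx)
  ... | false | false = there (count-<⇒disagreement P Q xs lt)
  ... | true  | true  = there (count-<⇒disagreement P Q xs (s<s⁻¹ lt))
  ... | true  | false = there (count-<⇒disagreement P Q xs (<-trans (n<1+n _) lt))

module Reorderings {X : Set} (_≟_ : DecidableEquality X) where

  swap : X → X → X → X
  swap a b x with x ≟ a | x ≟ b
  ... | yes _ | _     = b
  ... | no _  | yes _ = a
  ... | no _  | no _  = x

  swap-fixes : ∀ {a b x} → x ≢ a → x ≢ b → swap a b x ≡ x
  swap-fixes {a} {b} {x} x≢a x≢b with x ≟ a | x ≟ b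
  ... | yes x≡a | _       = contradiction x≡a x≢a
  ... | no _    | yes x≡b = contradiction x≡b x≢b
  ... | no _    | no _    = refl

  swap-first : ∀ a b → swap a b a ≡ b
  swap-first a b with a ≟ a
  ... | yes _  = refl
  ... | no a≢a = contradiction refl a≢a

  swap-second : ∀ a b → swap a b b ≡ a
  swap-second a b with b ≟ a | b ≟ b
  ... | yes b≡a | _      = b≡a
  ... | no _    | yes _  = refl
  ... | no _    | no b≢b = contradiction refl b≢b

  swap-involutive : ∀ a b x → swap a b (swap a b x) ≡ x
  swap-involutive a b x with x ≟ a | x ≟ b
  ... | yes refl | _        = swap-second x b
  ... | no _     | yes refl = swap-first a x
  ... | no x≢a   | no x≢b   = swap-fixes x≢a x≢b

  swap-preserves : {A : Set} (P : X → A) {a b : X} → P a ≡ P b → ∀ x → P (swap a b x) ≡ P x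
  swap-preserves P {a} {b} Pa≡Pb x with x ≟ a | x ≟ b
  ... | yes refl | _        = sym Pa≡Pb
  ... | no _     | yes refl = Pa≡Pb
  ... | no _     | no _     = refl

  swap-∈ : ∀ {a b x} {xs : List X} → a ∈ xs → b ∈ xs → x ∈ xs → swap a b x ∈ xs
  swap-∈ {a} {b} {x} a∈ b∈ x∈ with x ≟ a | x ≟ b
  ... | yes _ | _     = b∈
  ... | no _  | yes _ = a∈
  ... | no _  | no _  = x∈

  transposition : X → X → X ↔ X
  transposition a b = mk↔ₛ′ (swap a b) (swap a b) (swap-involutive a b) (swap-involutive a b)

  -- Fixing the complement of xs is what lets a reordering be extended one element at a time.
  Reordering : (P Q : X → Bool) → List X → Set
  Reordering P Q xs =
    Σ[ f ∈ X ↔ X ] (∀ {x} → x ∈ xs → P (to f x) ≡ Q x) × (∀ {x} → x ∉ xs → to f x ≡ x)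

  reordering-∷ : ∀ {P Q a xs} → a ∉ xs → P a ≡ Q a → Reordering P Q xs → Reordering P Q (a ∷ xs)
  reordering-∷ {P} {Q} {a} {xs} a∉ Pa≡Qa (f , agree , fixes) = f , agree′ , fixes ∘ (_∘ there)
    where
    agree′ : ∀ {x} → x ∈ a ∷ xs → P (to f x) ≡ Q x
    agree′ (here refl) = trans (cong P (fixes a∉)) Pa≡Qa
    agree′ (there x∈)  = agree x∈

  reordering-swap : ∀ {P Q a b xs} → a ∈ xs → b ∈ xs →
                    Reordering (P ∘ swap a b) Q xs → Reordering P Q xs
  reordering-swap {a = a} {b} a∈ b∈ (f , agree , fixes) = transposition a b ↔-∘ f , agree ,
    λ x∉ → trans (cong (swap a b) (fixes x∉)) (swap-fixes (λ { refl → x∉ a∈ }) (λ { refl → x∉ b∈ }))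

  count-∷-cancel : ∀ {P Q : X → Bool} {a} xs → P a ≡ Q a →
                   count P (a ∷ xs) ≡ count Q (a ∷ xs) → count P xs ≡ count Q xs
  count-∷-cancel {P} {Q} {a} xs Pa≡Qa e = +-cancelˡ-≡ (if Q a then 1 else 0) _ _ $
    trans (cong (λ b → (if b then 1 else 0) + count P xs) (sym Pa≡Qa)) e

  disagreement-witness : ∀ (P Q : X → Bool) a xs → P a ≢ Q a →
                         count P (a ∷ xs) ≡ count Q (a ∷ xs) → Any (λ b → P b ≡ Q a) xs
  disagreement-witness P Q a xs Pa≢Qa e with P a | Q a
  ... | true  | true  = contradiction refl Pa≢Qa
  ... | false | false = contradiction refl Pa≢Qa
  ... | true  | false = Any.map proj₁ (count-<⇒disagreement P Q xs (≤-reflexive e))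
  ... | false | true  = Any.map proj₂ (count-<⇒disagreement Q P xs (≤-reflexive (sym e)))

  reorder : (P Q : X → Bool) (xs : List X) → Unique xs → count P xs ≡ count Q xs → Reordering P Q xs
  reorder P Q []       _            _ = ↔-id X , (λ ()) , λ _ → refl
  reorder P Q (a ∷ xs) u@(_ ∷ xs!) e with P a ≟ᴮ Q a
  ... | yes Pa≡Qa =
    reordering-∷ (Unique.Unique[x∷xs]⇒x∉xs u) Pa≡Qa (reorder P Q xs xs! (count-∷-cancel xs Pa≡Qa e))
  ... | no Pa≢Qa with find (disagreement-witness P Q a xs Pa≢Qa e)
  ...   | b , b∈ , Pb≡Qa =
    reordering-swap {P = P} (here refl) (there b∈) $
      reordering-∷ {P = P′} (Unique.Unique[x∷xs]⇒x∉xs u) P′a≡Qa $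
        reorder P′ Q xs xs! (count-∷-cancel xs P′a≡Qa (trans count-P′≡count-P e))
    where
    P′ = P ∘ swap a b
    P′a≡Qa : P′ a ≡ Q a
    P′a≡Qa = trans (cong P (swap-first a b)) Pb≡Qa
    swap-∈-a∷xs : ∀ {x} → x ∈ a ∷ xs → swap a b x ∈ a ∷ xs
    swap-∈-a∷xs = swap-∈ (here refl) (there b∈)
    count-P′≡count-P : count P′ (a ∷ xs) ≡ count P (a ∷ xs)
    count-P′≡count-P = count-∘-↔ P (transposition a b) u swap-∈-a∷xs swap-∈-a∷xs

  reordering⇔ : {xs : List X} → Unique xs → (∀ x → x ∈ xs) → (P Q : X → Bool) (a b : X) →
                (∃[ f ] to f a ≡ b × (∀ x → P (to f x) ≡ Q x)) ⇔ (Q a ≡ P b × count Q xs ≡ count P xs)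
  reordering⇔ {xs} xs! complete P Q a b = mk⇔ necessary sufficient
    where
    necessary : ∃[ f ] to f a ≡ b × (∀ x → P (to f x) ≡ Q x) → Q a ≡ P b × count Q xs ≡ count P xs
    necessary (f , fa≡b , P∘f≗Q) = trans (sym (P∘f≗Q a)) (cong P fa≡b) ,
      trans (count-cong xs (sym ∘ P∘f≗Q)) (count-∘-↔ P f xs! (λ _ → complete _) (λ _ → complete _))
    sufficient : Q a ≡ P b × count Q xs ≡ count P xs → ∃[ f ] to f a ≡ b × (∀ x → P (to f x) ≡ Q x)
    sufficient (Qa≡Pb , e) with reorder P Q xs xs! (sym e)
    ... | f , agree , _ = transposition (to f a) b ↔-∘ f , swap-first (to f a) b ,
      λ x → trans (swap-preserves P (trans (agree (complete a)) Qa≡Pb) (to f x)) (agree (complete x))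

variable
  v : ℕ

_≟ⱽ_ : DecidableEquality (Val v)
_≟ⱽ_ = ≡-dec _≟ᴮ_

allVals-complete : (x : Val v) → x ∈ allVals v
allVals-complete         []          = here refl
allVals-complete {suc v} (true ∷ x)  = ∈-++⁺ˡ (∈-map⁺ (true ∷_) (allVals-complete x))
allVals-complete {suc v} (false ∷ x) =
  ∈-++⁺ʳ (map (true ∷_) (allVals v)) (∈-map⁺ (false ∷_) (allVals-complete x))

allVals-unique : Unique (allVals v)
allVals-unique {zero}  = All.[] ∷ []
allVals-unique {suc v} =
  Unique.++⁺ (Unique.map⁺ ∷-injectiveʳ allVals-unique) (Unique.map⁺ ∷-injectiveʳ allVals-unique) disjoint
  where
  disjoint : ∀ {x} → ¬ (x ∈ map (true ∷_) (allVals v) × x ∈ map (false ∷_) (allVals v))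
  disjoint (x∈ , x∈′) with ∈-map⁻ (true ∷_) x∈ | ∈-map⁻ (false ∷_) x∈′
  ... | _ , _ , refl | _ , _ , ()

tabulate-≗-lookup : {f : Fin v → Bool} {x : Val v} → (∀ k → f k ≡ lookup x k) → tabulate f ≡ x
tabulate-≗-lookup {x = x} f≗x = trans (tabulate-cong f≗x) (tabulate∘lookup x)

T-⇔⇒≡ : {a b : Bool} → T a ⇔ T b → a ≡ b
T-⇔⇒≡ {true}  {true}  _   = refl
T-⇔⇒≡ {true}  {false} a⇔b = ⊥-elim (⇔.to a⇔b tt)
T-⇔⇒≡ {false} {true}  a⇔b = ⊥-elim (⇔.from a⇔b tt)
T-⇔⇒≡ {false} {false} _   = refl

T-foldr-∨ : {A : Set} (h : A → Bool) (xs : List A) →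
            T (foldr (λ x b → h x ∨ b) false xs) ⇔ Any (T ∘ h) xs
T-foldr-∨ h []       = mk⇔ (λ ()) (λ ())
T-foldr-∨ h (x ∷ xs) = mk⇔ (Any.fromSum ∘ Sum.map₂ (⇔.to (T-foldr-∨ h xs)) ∘ ⇔.to T-∨)
                           (⇔.from T-∨ ∘ Sum.map₂ (⇔.from (T-foldr-∨ h xs)) ∘ Any.toSum)

T-anyV : (h : Val v → Bool) → T (anyV h) ⇔ (∃[ x ] T (h x))
T-anyV {v} h = mk⇔ (Any.satisfied ∘ ⇔.to (T-foldr-∨ h (allVals v)))
                   (λ (x , hx) → ⇔.from (T-foldr-∨ h (allVals v)) (lose (allVals-complete x) hx))

anyV-↔ : (f : Val v ↔ Val v) {h k : Val v → Bool} → (∀ x → h x ≡ k (to f x)) → anyV h ≡ anyV k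
anyV-↔ f {h} {k} h≗k∘f = T-⇔⇒≡ (mk⇔ forth back)
  where
  forth : T (anyV h) → T (anyV k)
  forth t = let (x , hx) = ⇔.to (T-anyV h) t in ⇔.from (T-anyV k) (to f x , subst T (h≗k∘f x) hx)
  back : T (anyV k) → T (anyV h)
  back t = let (y , ky) = ⇔.to (T-anyV k) t in
    ⇔.from (T-anyV h) (from f y , subst T (sym (trans (h≗k∘f _) (cong k (strictlyInverseˡ f y)))) ky)

anyV-singleton : {p : Val v → Bool} {j : Val v} → (∀ {x} → T (p x) → x ≡ j) → T (p j) →
                 (R : Val v → Bool) → anyV (λ x → R x ∧ p x) ≡ R j
anyV-singleton {p = p} {j} p⇒≡j pj R = T-⇔⇒≡ (mk⇔ forth back)
  where
  forth : T (anyV (λ x → R x ∧ p x)) → T (R j)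
  forth t = let (x , Rx∧px) = ⇔.to (T-anyV (λ x → R x ∧ p x)) t
                (Rx , px)   = ⇔.to T-∧ Rx∧px
            in subst (T ∘ R) (p⇒≡j px) Rx
  back : T (R j) → T (anyV (λ x → R x ∧ p x))
  back Rj = ⇔.from (T-anyV (λ x → R x ∧ p x)) (j , ⇔.from T-∧ (Rj , pj))

evalM-embed : (φ : Fm v) (x : Val v) (R : Val v → Bool) → evalM (embed φ) x R ≡ evalF φ x
evalM-embed (var k)  x R = refl
evalM-embed ⊥ᶠ       x R = refl
evalM-embed (¬ᶠ φ)   x R = cong not (evalM-embed φ x R)
evalM-embed (φ ∧ᶠ ψ) x R = cong₂ _∧_ (evalM-embed φ x R) (evalM-embed ψ x R)

T-conjF : (φs : List (Fm v)) (x : Val v) → T (evalF (conjF φs) x) ⇔ All (λ φ → T (evalF φ x)) φs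
T-conjF []       x = mk⇔ (λ _ → All.[]) (λ _ → tt)
T-conjF (φ ∷ φs) x = mk⇔
  (λ t → let (tφ , tφs) = ⇔.to T-∧ t in tφ All.∷ ⇔.to (T-conjF φs x) tφs)
  (λ { (tφ All.∷ tφs) → ⇔.from T-∧ (tφ , ⇔.from (T-conjF φs x) tφs) })

T-conjM : (φs : List (MFm v)) (x : Val v) (R : Val v → Bool) →
          T (evalM (conjM φs) x R) ⇔ All (λ φ → T (evalM φ x R)) φs
T-conjM []       x R = mk⇔ (λ _ → All.[]) (λ _ → tt)
T-conjM (φ ∷ φs) x R = mk⇔
  (λ t → let (tφ , tφs) = ⇔.to T-∧ t in tφ All.∷ ⇔.to (T-conjM φs x R) tφs)
  (λ { (tφ All.∷ tφs) → ⇔.from T-∧ (tφ , ⇔.from (T-conjM φs x R) tφs) })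

T-lit : (k : Fin v) (b : Bool) (x : Val v) → T (evalF (lit k b) x) ⇔ lookup x k ≡ b
T-lit k true  x = T-≡
T-lit k false x = T-not-≡

T-mt : (y x : Val v) → T (evalF (mt y) x) ⇔ x ≡ y
T-mt {v} y x = mk⇔ forth back
  where
  literals = map (λ k → lit k (lookup y k)) (allFin v)
  forth : T (evalF (mt y) x) → x ≡ y
  forth t = trans (sym (tabulate∘lookup x)) $ tabulate-≗-lookup λ k →
    ⇔.to (T-lit k _ x) (All.tabulate⁻ (All.map⁻ (⇔.to (T-conjF literals x) t)) k)
  back : x ≡ y → T (evalF (mt y) x)
  back refl = ⇔.from (T-conjF literals x) (All.map⁺ (All.tabulate⁺ λ k → ⇔.from (T-lit k _ x) refl))

evalM-◇-mt : (y x : Val v) (R : Val v → Bool) → evalM (◇ mt y) x R ≡ R y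
evalM-◇-mt y x R = anyV-singleton (⇔.to (T-mt y _)) (⇔.from (T-mt y y) refl) R

T-dia^-mt : (b : Bool) (y x : Val v) (R : Val v → Bool) → T (evalM (dia^ b (mt y)) x R) ⇔ R y ≡ b
T-dia^-mt true  y x R rewrite evalM-◇-mt y x R = T-≡
T-dia^-mt false y x R rewrite evalM-◇-mt y x R = T-not-≡

-- Semantically, a minterm of K[v,1] is a root valuation x₀ together with the set R₀ of
-- valuations realised at successors.
SatisfiedExactlyAt : MFm v → Val v → (Val v → Bool) → Set
SatisfiedExactlyAt φ x₀ R₀ = ∀ x R → T (evalM φ x R) ⇔ (x ≡ x₀ × (∀ y → R y ≡ R₀ y))

μ-satisfiedExactlyAt : (s : Val v) (ε : Val v → Bool) → SatisfiedExactlyAt (μ s ε) s ε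
μ-satisfiedExactlyAt {v} s ε x R = mk⇔ forth back
  where
  diamonds = map (λ i → dia^ (ε i) (mt i)) (allVals v)
  forth : T (evalM (μ s ε) x R) → x ≡ s × (∀ y → R y ≡ ε y)
  forth t = let (t-root , t-succ) = ⇔.to T-∧ t in
    ⇔.to (T-mt s x) (subst T (evalM-embed (mt s) x R) t-root) ,
    λ y → ⇔.to (T-dia^-mt (ε y) y x R)
            (All.lookup (All.map⁻ (⇔.to (T-conjM diamonds x R) t-succ)) (allVals-complete y))
  back : x ≡ s × (∀ y → R y ≡ ε y) → T (evalM (μ s ε) x R)
  back (x≡s , R≗ε) = ⇔.from T-∧
    ( subst T (sym (evalM-embed (mt s) x R)) (⇔.from (T-mt s x) x≡s)
    , ⇔.from (T-conjM diamonds x R)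
        (All.map⁺ (All.tabulate λ {y} _ → ⇔.from (T-dia^-mt (ε y) y x R) (R≗ε y))))

≈ᴷ⇔same-point : (φ ψ : MFm v) {x₀ x₁ : Val v} {R₀ R₁ : Val v → Bool} →
                SatisfiedExactlyAt φ x₀ R₀ → SatisfiedExactlyAt ψ x₁ R₁ →
                (φ ≈ᴷ ψ) ⇔ (x₀ ≡ x₁ × (∀ y → R₀ y ≡ R₁ y))
≈ᴷ⇔same-point φ ψ {x₀} {x₁} {R₀} {R₁} φ-at ψ-at = mk⇔ forth back
  where
  forth : φ ≈ᴷ ψ → x₀ ≡ x₁ × (∀ y → R₀ y ≡ R₁ y)
  forth φ≈ψ =
    let ψ-holds = ⇔.from (ψ-at x₁ R₁) (refl , λ _ → refl)
        (x₁≡x₀ , R₁≗R₀) = ⇔.to (φ-at x₁ R₁) (subst T (sym (φ≈ψ x₁ R₁)) ψ-holds)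
    in sym x₁≡x₀ , sym ∘ R₁≗R₀
  back : x₀ ≡ x₁ × (∀ y → R₀ y ≡ R₁ y) → φ ≈ᴷ ψ
  back (x₀≡x₁ , R₀≗R₁) x R = T-⇔⇒≡ $ mk⇔
    (λ t → let (x≡x₀ , R≗R₀) = ⇔.to (φ-at x R) t in
       ⇔.from (ψ-at x R) (trans x≡x₀ x₀≡x₁ , λ y → trans (R≗R₀ y) (R₀≗R₁ y)))
    (λ t → let (x≡x₁ , R≗R₁) = ⇔.to (ψ-at x R) t in
       ⇔.from (φ-at x R) (trans x≡x₁ (sym x₀≡x₁) , λ y → trans (R≗R₁ y) (sym (R₀≗R₁ y))))

⟦_⟧ : Subst v → Val v → Val v
⟦ σ ⟧ x = tabulate λ k → evalF (σ k) x

evalF-[]ᶠ : (φ : Fm v) (σ : Subst v) (x : Val v) → evalF (φ [ σ ]ᶠ) x ≡ evalF φ (⟦ σ ⟧ x)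
evalF-[]ᶠ (var k)  σ x = sym (lookup∘tabulate _ k)
evalF-[]ᶠ ⊥ᶠ       σ x = refl
evalF-[]ᶠ (¬ᶠ φ)   σ x = cong not (evalF-[]ᶠ φ σ x)
evalF-[]ᶠ (φ ∧ᶠ ψ) σ x = cong₂ _∧_ (evalF-[]ᶠ φ σ x) (evalF-[]ᶠ ψ σ x)

⟦⊙⟧ : (σ τ : Subst v) (x : Val v) → ⟦ σ ⊙ τ ⟧ x ≡ ⟦ σ ⟧ (⟦ τ ⟧ x)
⟦⊙⟧ σ τ x = tabulate-cong λ k → evalF-[]ᶠ (σ k) τ x

≈ᶜ-idS⇒⟦⟧≗id : (σ : Subst v) → (∀ i → σ i ≈ᶜ idS i) → ∀ x → ⟦ σ ⟧ x ≡ x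
≈ᶜ-idS⇒⟦⟧≗id σ σ≈id x = tabulate-≗-lookup λ k → σ≈id k x

⟦⟧≗id⇒≈ᶜ-idS : (σ : Subst v) → (∀ x → ⟦ σ ⟧ x ≡ x) → ∀ i → σ i ≈ᶜ idS i
⟦⟧≗id⇒≈ᶜ-idS σ ⟦σ⟧≗id i x =
  trans (sym (lookup∘tabulate (λ k → evalF (σ k) x) i)) (cong (λ y → lookup y i) (⟦σ⟧≗id x))

prime⇒↔ : {σ : Subst v} → Prime σ → Val v ↔ Val v
prime⇒↔ {σ = σ} (τ , σ⊙τ≈id , τ⊙σ≈id) = mk↔ₛ′ ⟦ σ ⟧ ⟦ τ ⟧
  (λ x → trans (sym (⟦⊙⟧ σ τ x)) (≈ᶜ-idS⇒⟦⟧≗id (σ ⊙ τ) σ⊙τ≈id x))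
  (λ x → trans (sym (⟦⊙⟧ τ σ x)) (≈ᶜ-idS⇒⟦⟧≗id (τ ⊙ σ) τ⊙σ≈id x))

inverse⇒prime : (σ τ : Subst v) →
                (∀ x → ⟦ σ ⟧ (⟦ τ ⟧ x) ≡ x) → (∀ x → ⟦ τ ⟧ (⟦ σ ⟧ x) ≡ x) → Prime σ
inverse⇒prime σ τ στ≗id τσ≗id =
  τ , ⟦⟧≗id⇒≈ᶜ-idS (σ ⊙ τ) (λ x → trans (⟦⊙⟧ σ τ x) (στ≗id x))
    , ⟦⟧≗id⇒≈ᶜ-idS (τ ⊙ σ) (λ x → trans (⟦⊙⟧ τ σ x) (τσ≗id x))

evalM-[]ᵐ : {σ : Subst v} (p : Prime σ) (φ : MFm v) (x : Val v) (R : Val v → Bool) →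
            evalM (φ [ σ ]ᵐ) x R ≡ evalM φ (⟦ σ ⟧ x) (R ∘ from (prime⇒↔ p))
evalM-[]ᵐ {σ = σ} p (var k) x R = trans (evalM-embed (σ k) x R) (sym (lookup∘tabulate _ k))
evalM-[]ᵐ p ⊥ᵐ       x R = refl
evalM-[]ᵐ p (¬ᵐ φ)   x R = cong not (evalM-[]ᵐ p φ x R)
evalM-[]ᵐ p (φ ∧ᵐ ψ) x R = cong₂ _∧_ (evalM-[]ᵐ p φ x R) (evalM-[]ᵐ p ψ x R)
evalM-[]ᵐ {σ = σ} p (◇ φ) x R =
  anyV-↔ f λ y → cong₂ _∧_ (cong R (sym (strictlyInverseʳ f y))) (evalF-[]ᶠ φ σ y)
  where f = prime⇒↔ p

[]ᵐ-satisfiedExactlyAt : {σ : Subst v} (p : Prime σ) (φ : MFm v) {x₀ : Val v} {R₀ : Val v → Bool} →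
                         SatisfiedExactlyAt φ x₀ R₀ →
                         SatisfiedExactlyAt (φ [ σ ]ᵐ) (from (prime⇒↔ p) x₀) (R₀ ∘ ⟦ σ ⟧)
[]ᵐ-satisfiedExactlyAt p φ {x₀} {R₀} φ-at x R = mk⇔ forth back
  where
  f = prime⇒↔ p
  φ-at-fx = φ-at (to f x) (R ∘ from f)
  forth : T (evalM (φ [ _ ]ᵐ) x R) → x ≡ from f x₀ × (∀ y → R y ≡ R₀ (to f y))
  forth t = let (fx≡x₀ , R∘g≗R₀) = ⇔.to φ-at-fx (subst T (evalM-[]ᵐ p φ x R) t) in
    sym (inverseʳ f (sym fx≡x₀)) , λ y → trans (cong R (sym (strictlyInverseʳ f y))) (R∘g≗R₀ (to f y))
  back : x ≡ from f x₀ × (∀ y → R y ≡ R₀ (to f y)) → T (evalM (φ [ _ ]ᵐ) x R)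
  back (x≡gx₀ , R≗R₀∘f) = subst T (sym (evalM-[]ᵐ p φ x R)) $
    ⇔.from φ-at-fx
      (inverseˡ f x≡gx₀ , λ y → trans (R≗R₀∘f (from f y)) (cong R₀ (strictlyInverseˡ f y)))

_∨ᶠ_ : Fm v → Fm v → Fm v
φ ∨ᶠ ψ = ¬ᶠ ((¬ᶠ φ) ∧ᶠ (¬ᶠ ψ))

evalF-∨ᶠ : (φ ψ : Fm v) (x : Val v) → evalF (φ ∨ᶠ ψ) x ≡ evalF φ x ∨ evalF ψ x
evalF-∨ᶠ φ ψ x with evalF φ x
... | true  = refl
... | false = not-involutive _

minterm-disjunction : (Val v → Bool) → List (Val v) → Fm v
minterm-disjunction h []       = ⊥ᶠ
minterm-disjunction h (y ∷ ys) = if h y then mt y ∨ᶠ minterm-disjunction h ys else minterm-disjunction h ys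

evalF-minterm-disjunction : (h : Val v → Bool) (ys : List (Val v)) (x : Val v) →
  evalF (minterm-disjunction h ys) x ≡ foldr (λ y b → (h y ∧ evalF (mt y) x) ∨ b) false ys
evalF-minterm-disjunction h []       x = refl
evalF-minterm-disjunction h (y ∷ ys) x with h y
... | true  = trans (evalF-∨ᶠ (mt y) (minterm-disjunction h ys) x)
                    (cong (evalF (mt y) x ∨_) (evalF-minterm-disjunction h ys x))
... | false = evalF-minterm-disjunction h ys x

dnf : (Val v → Bool) → Fm v
dnf {v} h = minterm-disjunction h (allVals v)

evalF-dnf : (h : Val v → Bool) (x : Val v) → evalF (dnf h) x ≡ h x
evalF-dnf {v} h x = trans (evalF-minterm-disjunction h (allVals v) x)
  (anyV-singleton (sym ∘ ⇔.to (T-mt _ x)) (⇔.from (T-mt x x) refl) h)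

represent : (Val v → Val v) → Subst v
represent F k = dnf λ x → lookup (F x) k

⟦represent⟧ : (F : Val v → Val v) (x : Val v) → ⟦ represent F ⟧ x ≡ F x
⟦represent⟧ F x = tabulate-≗-lookup λ k → evalF-dnf (λ y → lookup (F y) k) x

represent-prime : (f : Val v ↔ Val v) → Prime (represent (to f))
represent-prime f = inverse⇒prime (represent (to f)) (represent (from f))
  (represent-inverse (to f) (from f) (strictlyInverseˡ f))
  (represent-inverse (from f) (to f) (strictlyInverseʳ f))
  where
  represent-inverse : ∀ F G → (∀ x → F (G x) ≡ x) →
                      ∀ x → ⟦ represent F ⟧ (⟦ represent G ⟧ x) ≡ x
  represent-inverse F G FG≗id x =
    trans (⟦represent⟧ F (⟦ represent G ⟧ x)) (trans (cong F (⟦represent⟧ G x)) (FG≗id x))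

inPrimeOrbit-μ⇔ : (s : Val v) (ε : Val v → Bool) (s′ : Val v) (ε′ : Val v → Bool) →
  InPrimeOrbit (μ s ε) (μ s′ ε′) ⇔ (∃[ f ] to f s′ ≡ s × (∀ x → ε (to f x) ≡ ε′ x))
inPrimeOrbit-μ⇔ s ε s′ ε′ = mk⇔ forth back
  where
  orbit⇔ : {σ : Subst _} (p : Prime σ) →
           ((μ s ε [ σ ]ᵐ) ≈ᴷ μ s′ ε′) ⇔
           (from (prime⇒↔ p) s ≡ s′ × (∀ x → ε (⟦ σ ⟧ x) ≡ ε′ x))
  orbit⇔ {σ} p = ≈ᴷ⇔same-point (μ s ε [ σ ]ᵐ) (μ s′ ε′)
    ([]ᵐ-satisfiedExactlyAt p (μ s ε) (μ-satisfiedExactlyAt s ε)) (μ-satisfiedExactlyAt s′ ε′)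
  forth : InPrimeOrbit (μ s ε) (μ s′ ε′) → ∃[ f ] to f s′ ≡ s × (∀ x → ε (to f x) ≡ ε′ x)
  forth (σ , p , σμ≈μ′) = let (gs≡s′ , ε∘f≗ε′) = ⇔.to (orbit⇔ p) σμ≈μ′ in
    prime⇒↔ p , inverseˡ (prime⇒↔ p) (sym gs≡s′) , ε∘f≗ε′
  back : ∃[ f ] to f s′ ≡ s × (∀ x → ε (to f x) ≡ ε′ x) → InPrimeOrbit (μ s ε) (μ s′ ε′)
  back (f , fs′≡s , ε∘f≗ε′) = represent (to f) , represent-prime f ,
    ⇔.from (orbit⇔ (represent-prime f))
      ( trans (⟦represent⟧ (from f) s) (inverseʳ f (sym fs′≡s))
      , λ x → trans (cong ε (⟦represent⟧ (to f) x)) (ε∘f≗ε′ x))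

lemma7 : (v : ℕ) → 1 ≤ v → (s : Val v) (ε : Val v → Bool)
    → (s' : Val v) (ε' : Val v → Bool)
    → InPrimeOrbit (μ s ε) (μ s' ε') ⇔ ((ε' s' ≡ ε s) × (χ ε' ≡ χ ε))
lemma7 v _ s ε s' ε' =
  reordering⇔ allVals-unique allVals-complete ε ε' s' s ⇔-∘ inPrimeOrbit-μ⇔ s ε s' ε'
  where open Reorderings _≟ⱽ_
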